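{- Let $\Lambda$ be the semigroup generated by $\begin{pmatrix}1&4\\0&1\end{pmatrix}$ and $\begin{pmatrix}1&0\\4&1\end{pmatrix}$, and let $\mathcal O=\Lambda\cdot(3,5)^t$. Then every vector $(a,b)^t\in\mathcal O$ satisfies $\left(\frac{a}{b}\right)=-1$, where $\left(\frac{\cdot}{\cdot}\right)$ is the Jacobi symbol. In particular, the entry $a$ is never a perfect square. -}

module Defs where

open import Data.Nat using (ℕ; zero; suc; _+_; _*_; _%_; _≡ᵇ_)
open import Data.Nat.Divisibility using (_∣?_)
open import Data.Nat.Primality.Factorisation using (factorise; PrimeFactorisation; factors)
open import Data.Integer as ℤ using (ℤ; +_; -[1+_])
open import Data.List using (List; []; _∷_; upTo; map; foldr)
open import Data.Bool.ListAction using (any)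
open import Data.Bool using (Bool; false; if_then_else_)
open import Data.Product using (_×_; _,_)
open import Relation.Nullary.Decidable using (does)

-- 2×2 matrices and column vectors with entries in ℕ.
-- (All generators and the starting vector have nonnegative entries,
--  so the semigroup Λ and the orbit O live inside ℕ-matrices/vectors.)

record Mat2 : Set where
  constructor mat
  field
    m11 m12 m21 m22 : ℕ

Vec2 : Set
Vec2 = ℕ × ℕ

_⊗_ : Mat2 → Mat2 → Mat2
mat a b c d ⊗ mat a' b' c' d' =
  mat (a * a' + b * c') (a * b' + b * d') (c * a' + d * c') (c * b' + d * d')

_·_ : Mat2 → Vec2 → Vec2
mat a b c d · (x , y) = (a * x + b * y , c * x + d * y)

T4 : Mat2
T4 = mat 1 4 0 1

U4 : Mat2
U4 = mat 1 0 4 1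

data InΛ : Mat2 → Set where
  genT : InΛ T4
  genU : InΛ U4
  mul  : ∀ {M N} → InΛ M → InΛ N → InΛ (M ⊗ N)

data InO : Vec2 → Set where
  orb : ∀ {M} → InΛ M → InO (M · (3 , 5))

isQR : ℕ → ℕ → Bool
isQR a zero    = false
isQR a (suc q) = any (λ x → ((x * x) % suc q) ≡ᵇ (a % suc q)) (upTo (suc q))

legendre : ℕ → ℕ → ℤ
legendre a p =
  if does (p ∣? a) then + 0
  else (if isQR a p then + 1 else -[1+ 0 ])

-- Jacobi symbol (a/b) = ∏ (a/p) over the prime factorisation of b
-- (multiplicities included); the value at b = 0 is irrelevant (set to 0).
jacobi : ℕ → ℕ → ℤ
jacobi a zero    = + 0
jacobi a (suc n) = foldr ℤ._*_ (+ 1) (map (legendre a) (factors (factorise (suc n))))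

-- Every vector (a, b) of the orbit satisfies a ≡ 3 and b ≡ 1 (mod 4), gcd (a, b) = 1 and
-- (a/b) = -1: these hold for (3, 5) and survive both generators.  Under (a, b) ↦ (a + 4b, b) the
-- symbol does not change because (·/b) only sees residues modulo b.  Under (a, b) ↦ (a, 4a + b),
-- Jacobi reciprocity for a denominator ≡ 1 (mod 4), namely (x/y) = (y/x), gives
-- (a/4a+b) = (4a+b/a) = (b/a) = (a/b).  Finally (k²/b) is a product of Legendre symbols equal
-- to 0 or 1, so it is never -1 and a is not a square.
--
-- Reciprocity is proved from scratch: Euler's criterion (from Fermat's and Wilson's theorems,
-- both obtained by pairing residues), Gauss's lemma, Eisenstein's parity version of it, and the
-- count of lattice points on either side of the diagonal of [1, (p-1)/2] × [1, (q-1)/2].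

module Submission where

open import Algebra.Bundles using (CommutativeMonoid)
open import Algebra.Morphism.Structures using (IsMonoidHomomorphism)
open import Data.Bool using (true; false; T; if_then_else_)
open import Data.Bool.ListAction using (any)
open import Data.Integer as ℤ using (ℤ; 0ℤ; 1ℤ; -1ℤ; -[1+_])
import Data.Integer.Properties as ℤ
open import Data.List using (List; []; _∷_; _++_; map; foldr; length; upTo)
open import Data.List.Membership.Propositional using (_∈_; _∉_; lose)
open import Data.List.Membership.Propositional.Properties using (∈-∃++; ∈-insert; ∈-map⁻; ∈-upTo⁺)
open import Data.List.Properties using (length-map; map-id)
open import Data.List.Relation.Binary.Permutation.Propositional
  using (_↭_; prep; ↭-refl; ↭-sym; ↭-trans; ↭⇒↭ₛ)
open import Data.List.Relation.Binary.Permutation.Propositional.Properties using (shift; ∈-resp-↭; ↭-length)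
import Data.List.Relation.Binary.Permutation.Setoid.Properties as ↭ₛ
open import Data.List.Relation.Binary.Subset.Propositional using (_⊆_)
open import Data.List.Relation.Unary.All as All using (All; []; _∷_)
import Data.List.Relation.Unary.All.Properties as All
open import Data.List.Relation.Unary.Any using (here; there; satisfied)
open import Data.List.Relation.Unary.Any.Properties using (any⁺; any⁻)
open import Data.List.Relation.Unary.Unique.Propositional using (Unique; []; _∷_)
open import Data.Nat
open import Data.Nat.Coprimality using (Coprime; gcd≡1⇒coprime) renaming (sym to coprime-sym)
open import Data.Nat.DivMod
open import Data.Nat.Divisibility
  using ( _∣_; _∤_; _∣?_; divides; n∣m⇒m%n≡0; m%n≡0⇒n∣m; ∣⇒≤; ∣m⇒∣m*n; ∣n⇒∣m*n; ∣-refl; ∣-trans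
        ; ∣m+n∣m⇒∣n; n∣m*n)
open import Data.Nat.ListAction using (sum; product)
open import Data.Nat.ListAction.Properties using (sum-↭; product-↭; product-++)
open import Data.Nat.Primality using (Prime; euclidsLemma; ¬prime[1]; prime⇒irreducible)
open import Data.Nat.Primality.Factorisation using (factorise; PrimeFactorisation)
open import Data.Nat.Properties
open import Algebra.Properties.CommutativeSemigroup *-commutativeSemigroup
  using () renaming (interchange to *-interchange)
open import Data.Nat.Tactic.RingSolver using (solve-∀)
open import Data.Product using (_×_; _,_; proj₁; proj₂; ∃-syntax)
open import Data.Sum using (_⊎_; inj₁; inj₂)
open import Data.Unit using (tt)
open import Defs
open import Function using (_∘_)
open import Level using (0ℓ)
open import Relation.Binary.Bundles using (Setoid)
open import Relation.Binary.Definitions using (_Respects_)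
import Relation.Binary.PropositionalEquality as ≡
open import Relation.Binary.PropositionalEquality
  using (_≡_; _≢_; refl; sym; trans; cong; cong₂; subst; module ≡-Reasoning)
open import Relation.Binary.Structures using (IsEquivalence)
open import Relation.Nullary using (¬_; contradiction; yes; no)
open import Relation.Nullary.Decidable using (dec-true; dec-false)

module FoldMap {c ℓ} (M : CommutativeMonoid c ℓ) where
  open CommutativeMonoid M
    using (Carrier; _≈_; _∙_; ε; ∙-cong; ∙-congˡ; identityˡ; setoid; commutativeSemigroup)
  open import Algebra.Properties.CommutativeSemigroup commutativeSemigroup using (interchange)
  open import Relation.Binary.Reasoning.Setoid setoid
  private module M = CommutativeMonoid M

  foldMap : ∀ {a} {A : Set a} → (A → Carrier) → List A → Carrier
  foldMap f xs = foldr _∙_ ε (map f xs)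

  foldMap-cong : ∀ {a} {A : Set a} {f g : A → Carrier} xs → (∀ {x} → x ∈ xs → f x ≈ g x) →
                 foldMap f xs ≈ foldMap g xs
  foldMap-cong []       f≈g = M.refl
  foldMap-cong (x ∷ xs) f≈g = ∙-cong (f≈g (here refl)) (foldMap-cong xs (f≈g ∘ there))

  foldMap-ε : ∀ {a} {A : Set a} (xs : List A) → foldMap (λ _ → ε) xs ≈ ε
  foldMap-ε []       = M.refl
  foldMap-ε (x ∷ xs) = M.trans (identityˡ _) (foldMap-ε xs)

  foldMap-∙ : ∀ {a} {A : Set a} (f g : A → Carrier) xs →
              foldMap (λ x → f x ∙ g x) xs ≈ foldMap f xs ∙ foldMap g xs
  foldMap-∙ f g []       = M.sym (identityˡ ε)
  foldMap-∙ f g (x ∷ xs) = begin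
    (f x ∙ g x) ∙ foldMap (λ x → f x ∙ g x) xs ≈⟨ ∙-congˡ (foldMap-∙ f g xs) ⟩
    (f x ∙ g x) ∙ (foldMap f xs ∙ foldMap g xs) ≈⟨ interchange (f x) (g x) _ _ ⟩
    (f x ∙ foldMap f xs) ∙ (g x ∙ foldMap g xs) ∎

  foldMap-closed : ∀ {a p} {A : Set a} (P : Carrier → Set p) → P ε → (∀ {x y} → P x → P y → P (x ∙ y)) →
                   ∀ {f : A → Carrier} xs → (∀ {x} → x ∈ xs → P (f x)) → P (foldMap f xs)
  foldMap-closed P Pε P∙ []       _  = Pε
  foldMap-closed P Pε P∙ (x ∷ xs) Pf = P∙ (Pf (here refl)) (foldMap-closed P Pε P∙ xs (Pf ∘ there))

  foldMap-comm : ∀ {a b} {A : Set a} {B : Set b} (F : A → B → Carrier) xs ys →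
                 foldMap (λ x → foldMap (F x) ys) xs ≈ foldMap (λ y → foldMap (λ x → F x y) xs) ys
  foldMap-comm F []       ys = M.sym (foldMap-ε ys)
  foldMap-comm F (x ∷ xs) ys = begin
    foldMap (F x) ys ∙ foldMap (λ x → foldMap (F x) ys) xs             ≈⟨ ∙-congˡ (foldMap-comm F xs ys) ⟩
    foldMap (F x) ys ∙ foldMap (λ y → foldMap (λ x → F x y) xs) ys     ≈⟨ M.sym (foldMap-∙ (F x) _ ys) ⟩
    foldMap (λ y → F x y ∙ foldMap (λ x → F x y) xs) ys                ∎

module _ {c₁ ℓ₁ c₂ ℓ₂} (M : CommutativeMonoid c₁ ℓ₁) (N : CommutativeMonoid c₂ ℓ₂) where
  private
    module M = CommutativeMonoid M
    module N = CommutativeMonoid N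
  open FoldMap

  foldMap-homo : ∀ {h : M.Carrier → N.Carrier} → IsMonoidHomomorphism M.rawMonoid N.rawMonoid h →
                 ∀ {a} {A : Set a} (f : A → M.Carrier) xs → h (foldMap M f xs) N.≈ foldMap N (h ∘ f) xs
  foldMap-homo h-homo f []       = ε-homo
    where open IsMonoidHomomorphism h-homo
  foldMap-homo h-homo f (x ∷ xs) = N.trans (homo (f x) _) (N.∙-congˡ (foldMap-homo h-homo f xs))
    where open IsMonoidHomomorphism h-homo

-- Sum.foldMap f xs, Product.foldMap f xs and ℤProduct.foldMap (legendre a) (primeFactors n) are
-- definitionally sum (map f xs), product (map f xs) and jacobi a n (for n ≢ 0).
module Sum     = FoldMap +-0-commutativeMonoid
module Product = FoldMap *-1-commutativeMonoid

module ℤProduct = FoldMap ℤ.*-1-commutativeMonoid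

^-isMonoidHomomorphism : ∀ b → IsMonoidHomomorphism +-0-rawMonoid *-1-rawMonoid (b ^_)
^-isMonoidHomomorphism b = record
  { isMagmaHomomorphism = record
    { isRelHomomorphism = record { cong = cong (b ^_) }
    ; homo              = ^-distribˡ-+-* b
    }
  ; ε-homo = refl
  }

sum-map-const : ∀ {a} {A : Set a} c (xs : List A) → sum (map (λ _ → c) xs) ≡ length xs * c
sum-map-const c []       = refl
sum-map-const c (x ∷ xs) = cong (c +_) (sum-map-const c xs)

sum-map-*ˡ : ∀ {a} {A : Set a} c (f : A → ℕ) xs → sum (map (λ x → c * f x) xs) ≡ c * sum (map f xs)
sum-map-*ˡ c f []       = sym (*-zeroʳ c)
sum-map-*ˡ c f (x ∷ xs) = trans (cong (c * f x +_) (sum-map-*ˡ c f xs)) (sym (*-distribˡ-+ c (f x) _))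

sum-map-*ʳ : ∀ {a} {A : Set a} c (f : A → ℕ) xs → sum (map (λ x → f x * c) xs) ≡ sum (map f xs) * c
sum-map-*ʳ c f []       = refl
sum-map-*ʳ c f (x ∷ xs) = trans (cong (f x * c +_) (sum-map-*ʳ c f xs)) (sym (*-distribʳ-+ c (f x) _))

product-map-*ˡ : ∀ a xs → product (map (a *_) xs) ≡ a ^ length xs * product xs
product-map-*ˡ a []       = refl
product-map-*ˡ a (x ∷ xs) = begin
  a * x * product (map (a *_) xs)       ≡⟨ cong (a * x *_) (product-map-*ˡ a xs) ⟩
  a * x * (a ^ length xs * product xs)  ≡⟨ *-interchange a x _ _ ⟩
  a * a ^ length xs * (x * product xs)  ∎
  where open ≡-Reasoning

segment : ℕ → ℕ → List ℕ
segment b zero    = []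
segment b (suc k) = b + suc k ∷ segment b k

length-segment : ∀ b k → length (segment b k) ≡ k
length-segment b zero    = refl
length-segment b (suc k) = cong suc (length-segment b k)

∈-segment⁻ : ∀ {b k x} → x ∈ segment b k → b < x × x ≤ b + k
∈-segment⁻ {b} {suc k} (here refl) = m<m+n b z<s , ≤-refl
∈-segment⁻ {b} {suc k} (there x∈) with b<x , x≤b+k ← ∈-segment⁻ x∈ =
  b<x , ≤-trans x≤b+k (+-monoʳ-≤ b (n≤1+n k))

∈-segment⁺ : ∀ {b k x} → b < x → x ≤ b + k → x ∈ segment b k
∈-segment⁺ {b} {zero}  b<x x≤b+k = contradiction (subst (_ ≤_) (+-identityʳ b) x≤b+k) (<⇒≱ b<x)
∈-segment⁺ {b} {suc k} {x} b<x x≤b+k with m≤n⇒m<n∨m≡n x≤b+k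
... | inj₂ refl = here refl
... | inj₁ x<b+1+k = there (∈-segment⁺ b<x (≤-pred (subst (x <_) (+-suc b k) x<b+1+k)))

segment-unique : ∀ b k → Unique (segment b k)
segment-unique b zero    = []
segment-unique b (suc k) =
  All.tabulate (λ y∈ b+1+k≡y → <-irrefl (sym b+1+k≡y)
                  (<-≤-trans (s≤s (proj₂ (∈-segment⁻ y∈))) (≤-reflexive (sym (+-suc b k)))))
  ∷ segment-unique b k

segment-∷ʳ : ∀ b k → segment b (suc k) ≡ segment (suc b) k ++ b + 1 ∷ []
segment-∷ʳ b zero    = refl
segment-∷ʳ b (suc k) = cong₂ _∷_ (+-suc b (suc k)) (segment-∷ʳ b k)

module _ {a} {A : Set a} where

  InjectiveOn : (A → A) → List A → Set a
  InjectiveOn f xs = ∀ {x y} → x ∈ xs → y ∈ xs → f x ≡ f y → x ≡ y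

  Unique-resp-↭ : Unique {A = A} Respects _↭_
  Unique-resp-↭ xs↭ys = ↭ₛ.Unique-resp-↭ (≡.setoid A) (↭⇒↭ₛ xs↭ys)

  Unique-dropMiddle : ∀ (xs : List A) {y ys} → Unique (xs ++ y ∷ ys) → y ∉ xs ++ ys × Unique (xs ++ ys)
  Unique-dropMiddle xs {y} {ys} u with y≢ ∷ u′ ← Unique-resp-↭ (shift y xs ys) u =
    (λ y∈ → All.lookup y≢ y∈ refl) , u′

  ∈-dropMiddle : ∀ (xs : List A) {y ys z} → z ∈ xs ++ y ∷ ys → z ≢ y → z ∈ xs ++ ys
  ∈-dropMiddle xs {y} {ys} z∈ z≢y with ∈-resp-↭ (shift y xs ys) z∈
  ... | here z≡y = contradiction z≡y z≢y
  ... | there z∈′ = z∈′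

  ⊆-insertMiddle : ∀ (xs : List A) {y ys} → xs ++ ys ⊆ xs ++ y ∷ ys
  ⊆-insertMiddle xs {y} {ys} z∈ = ∈-resp-↭ (↭-sym (shift y xs ys)) (there z∈)

  length-dropMiddle : ∀ (xs : List A) {y ys} → length (xs ++ y ∷ ys) ≡ suc (length (xs ++ ys))
  length-dropMiddle xs {y} {ys} = ↭-length (shift y xs ys)

  unique-⊆⇒↭ : ∀ {xs ys : List A} → Unique xs → xs ⊆ ys → length xs ≡ length ys → xs ↭ ys
  unique-⊆⇒↭ {[]}     {[]}    _          _    _   = ↭-refl
  unique-⊆⇒↭ {x ∷ xs} {ys}    (x∉ ∷ uxs) x∷xs⊆ys len
    with as , bs , refl ← ∈-∃++ (x∷xs⊆ys (here refl)) =
    ↭-trans (prep x (unique-⊆⇒↭ uxs xs⊆as++bs len′)) (↭-sym (shift x as bs))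
    where
    xs⊆as++bs : xs ⊆ as ++ bs
    xs⊆as++bs z∈ = ∈-dropMiddle as (x∷xs⊆ys (there z∈)) (λ { refl → All.lookup x∉ z∈ refl })
    len′ : length xs ≡ length (as ++ bs)
    len′ = suc-injective (trans len (length-dropMiddle as))

  Unique-map⁺ : ∀ {f : A → A} {xs} → Unique xs → InjectiveOn f xs → Unique (map f xs)
  Unique-map⁺ {xs = []}     []          _   = []
  Unique-map⁺ {xs = x ∷ xs} (x∉ ∷ uxs) inj =
    All.tabulate (λ fy∈ fx≡fy → let y , y∈ , fy≡ = ∈-map⁻ _ fy∈ in
                   All.lookup x∉ y∈ (inj (here refl) (there y∈) (trans fx≡fy fy≡)))
    ∷ Unique-map⁺ uxs (λ x∈ y∈ → inj (there x∈) (there y∈))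

  injective-selfMap⇒↭ : ∀ {f : A → A} {xs} → Unique xs → (∀ {x} → x ∈ xs → f x ∈ xs) →
                        InjectiveOn f xs → map f xs ↭ xs
  injective-selfMap⇒↭ {f} {xs} uxs f∈ inj =
    unique-⊆⇒↭ (Unique-map⁺ uxs inj) fx∈ (length-map f xs)
    where
    fx∈ : map f xs ⊆ xs
    fx∈ fy∈ with y , y∈ , refl ← ∈-map⁻ f fy∈ = f∈ y∈

^-distribʳ-* : ∀ x y n → (x * y) ^ n ≡ x ^ n * y ^ n
^-distribʳ-* x y zero    = refl
^-distribʳ-* x y (suc n) = trans (cong (x * y *_) (^-distribʳ-* x y n)) (*-interchange x y _ _)

+-double-injective : ∀ {m n} → m + m ≡ n + n → m ≡ n
+-double-injective {m} {n} eq = trans (n≡⌊n+n/2⌋ m) (trans (cong ⌊_/2⌋ eq) (sym (n≡⌊n+n/2⌋ n)))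

[1+n]²≡1+n[2+n] : ∀ n → suc n * suc n ≡ 1 + n * (2 + n)
[1+n]²≡1+n[2+n] = solve-∀

module Modulo (n : ℕ) .{{_ : NonZero n}} where

  -- A record rather than x % n ≡ y % n, so that x and y can be inferred from a proof.
  infix 4 _≈_
  record _≈_ (x y : ℕ) : Set where
    constructor mk≈
    field ≈⇒%≡ : x % n ≡ y % n

  ≡⇒≈ : ∀ {x y} → x ≡ y → x ≈ y
  ≡⇒≈ x≡y = mk≈ (cong (_% n) x≡y)

  ≈-isEquivalence : IsEquivalence _≈_
  ≈-isEquivalence = record
    { refl  = mk≈ refl
    ; sym   = λ (mk≈ e) → mk≈ (sym e)
    ; trans = λ (mk≈ e) (mk≈ f) → mk≈ (trans e f)
    }

  ≈-setoid : Setoid 0ℓ 0ℓ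
  ≈-setoid = record { isEquivalence = ≈-isEquivalence }

  open IsEquivalence ≈-isEquivalence public
    using () renaming (refl to ≈-refl; sym to ≈-sym; trans to ≈-trans)

  %-≈ : ∀ x → x % n ≈ x
  %-≈ x = mk≈ (m%n%n≡m%n x n)

  +-cong : ∀ {a b c d} → a ≈ b → c ≈ d → a + c ≈ b + d
  +-cong {a} {b} {c} {d} (mk≈ a≈b) (mk≈ c≈d) = mk≈ (begin
    (a + c) % n             ≡⟨ %-distribˡ-+ a c n ⟩
    (a % n + c % n) % n     ≡⟨ cong₂ (λ u v → (u + v) % n) a≈b c≈d ⟩
    (b % n + d % n) % n     ≡⟨ %-distribˡ-+ b d n ⟨
    (b + d) % n             ∎)
    where open ≡-Reasoning

  *-cong : ∀ {a b c d} → a ≈ b → c ≈ d → a * c ≈ b * d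
  *-cong {a} {b} {c} {d} (mk≈ a≈b) (mk≈ c≈d) = mk≈ (begin
    (a * c) % n             ≡⟨ %-distribˡ-* a c n ⟩
    (a % n * (c % n)) % n   ≡⟨ cong₂ (λ u v → (u * v) % n) a≈b c≈d ⟩
    (b % n * (d % n)) % n   ≡⟨ %-distribˡ-* b d n ⟨
    (b * d) % n             ∎)
    where open ≡-Reasoning

  +-congˡ : ∀ a {b c} → b ≈ c → a + b ≈ a + c
  +-congˡ a = +-cong (≈-refl {a})

  +-congʳ : ∀ a {b c} → b ≈ c → b + a ≈ c + a
  +-congʳ a b≈c = +-cong b≈c (≈-refl {a})

  *-congˡ : ∀ a {b c} → b ≈ c → a * b ≈ a * c
  *-congˡ a = *-cong (≈-refl {a})

  *-congʳ : ∀ a {b c} → b ≈ c → b * a ≈ c * a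
  *-congʳ a b≈c = *-cong b≈c (≈-refl {a})

  ^-congˡ : ∀ {a b} k → a ≈ b → a ^ k ≈ b ^ k
  ^-congˡ zero    a≈b = ≈-refl
  ^-congˡ (suc k) a≈b = *-cong a≈b (^-congˡ k a≈b)

  +-commutativeMonoid : CommutativeMonoid 0ℓ 0ℓ
  +-commutativeMonoid = record
    { _≈_ = _≈_
    ; _∙_ = _+_
    ; ε   = 0
    ; isCommutativeMonoid = record
      { isMonoid = record
        { isSemigroup = record
          { isMagma = record { isEquivalence = ≈-isEquivalence ; ∙-cong = +-cong }
          ; assoc   = λ x y z → ≡⇒≈ (+-assoc x y z)
          }
        ; identity = (λ x → ≡⇒≈ (+-identityˡ x)) , (λ x → ≡⇒≈ (+-identityʳ x))
        }
      ; comm = λ x y → ≡⇒≈ (+-comm x y)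
      }
    }

  *-commutativeMonoid : CommutativeMonoid 0ℓ 0ℓ
  *-commutativeMonoid = record
    { _≈_ = _≈_
    ; _∙_ = _*_
    ; ε   = 1
    ; isCommutativeMonoid = record
      { isMonoid = record
        { isSemigroup = record
          { isMagma = record { isEquivalence = ≈-isEquivalence ; ∙-cong = *-cong }
          ; assoc   = λ x y z → ≡⇒≈ (*-assoc x y z)
          }
        ; identity = (λ x → ≡⇒≈ (*-identityˡ x)) , (λ x → ≡⇒≈ (*-identityʳ x))
        }
      ; comm = λ x y → ≡⇒≈ (*-comm x y)
      }
    }

  ∣⇒≈0 : ∀ {x} → n ∣ x → x ≈ 0
  ∣⇒≈0 {x} n∣x = mk≈ (trans (n∣m⇒m%n≡0 x n n∣x) (sym (m*n%n≡0 0 n)))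

  ≈0⇒∣ : ∀ {x} → x ≈ 0 → n ∣ x
  ≈0⇒∣ {x} (mk≈ x%n≡0%n) = m%n≡0⇒n∣m x n (trans x%n≡0%n (m*n%n≡0 0 n))

  ≈⇒∣∸ : ∀ {x y} → y ≤ x → x ≈ y → n ∣ x ∸ y
  ≈⇒∣∸ {x} {y} y≤x (mk≈ x%n≡y%n) = divides (x / n ∸ y / n) (begin
    x ∸ y                                     ≡⟨ cong₂ _∸_ (m≡m%n+[m/n]*n x n) (m≡m%n+[m/n]*n y n) ⟩
    (x % n + x / n * n) ∸ (y % n + y / n * n) ≡⟨ cong (λ r → (r + x / n * n) ∸ (y % n + y / n * n)) x%n≡y%n ⟩
    (y % n + x / n * n) ∸ (y % n + y / n * n) ≡⟨ [m+n]∸[m+o]≡n∸o (y % n) _ _ ⟩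
    x / n * n ∸ y / n * n                     ≡⟨ *-distribʳ-∸ n (x / n) (y / n) ⟨
    (x / n ∸ y / n) * n                       ∎)
    where open ≡-Reasoning

  ∣∸⇒≈ : ∀ {x y} → y ≤ x → n ∣ x ∸ y → x ≈ y
  ∣∸⇒≈ {x} {y} y≤x n∣x∸y = mk≈ (trans (cong (_% n) (sym (m+[n∸m]≡n y≤x))) (%-remove-+ʳ y n∣x∸y))

  ≈⇒≡ : ∀ {x y} → x < n → y < n → x ≈ y → x ≡ y
  ≈⇒≡ x<n y<n (mk≈ x%n≡y%n) = trans (sym (m<n⇒m%n≡m x<n)) (trans x%n≡y%n (m<n⇒m%n≡m y<n))

module Parity = Modulo 2
open Parity using () renaming (_≈_ to _≡₂_)

2∣n+n : ∀ n → 2 ∣ n + n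
2∣n+n n = divides n (trans (cong (n +_) (sym (+-identityʳ n))) (*-comm 2 n))

n+n≡₂0 : ∀ n → n + n ≡₂ 0
n+n≡₂0 n = Parity.∣⇒≈0 (2∣n+n n)

1+n+n≡₂1 : ∀ n → suc (n + n) ≡₂ 1
1+n+n≡₂1 n = Parity.+-cong {1} {1} Parity.≈-refl (n+n≡₂0 n)

-1^-cong : ∀ {m n} → m ≡₂ n → -1ℤ ℤ.^ m ≡ -1ℤ ℤ.^ n
-1^-cong {m} {n} (Parity.mk≈ m%2≡n%2) =
  trans (-1^n≡-1^[n%2] m) (trans (cong (-1ℤ ℤ.^_) m%2≡n%2) (sym (-1^n≡-1^[n%2] n)))
  where
  -1^n≡-1^[n%2] : ∀ n → -1ℤ ℤ.^ n ≡ -1ℤ ℤ.^ (n % 2)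
  -1^n≡-1^[n%2] n = begin
    -1ℤ ℤ.^ n                                    ≡⟨ cong (-1ℤ ℤ.^_) (m≡m%n+[m/n]*n n 2) ⟩
    -1ℤ ℤ.^ (n % 2 + n / 2 * 2)                  ≡⟨ ℤ.^-distribˡ-+-* -1ℤ (n % 2) _ ⟩
    -1ℤ ℤ.^ (n % 2) ℤ.* -1ℤ ℤ.^ (n / 2 * 2)      ≡⟨ cong (λ e → -1ℤ ℤ.^ (n % 2) ℤ.* -1ℤ ℤ.^ e) (*-comm (n / 2) 2) ⟩
    -1ℤ ℤ.^ (n % 2) ℤ.* -1ℤ ℤ.^ (2 * (n / 2))    ≡⟨ cong (-1ℤ ℤ.^ (n % 2) ℤ.*_) (ℤ.^-*-assoc -1ℤ 2 (n / 2)) ⟨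
    -1ℤ ℤ.^ (n % 2) ℤ.* (-1ℤ ℤ.^ 2) ℤ.^ (n / 2)  ≡⟨ cong (-1ℤ ℤ.^ (n % 2) ℤ.*_) (ℤ.^-zeroˡ (n / 2)) ⟩
    -1ℤ ℤ.^ (n % 2) ℤ.* 1ℤ                       ≡⟨ ℤ.*-identityʳ _ ⟩
    -1ℤ ℤ.^ (n % 2)                              ∎
    where open ≡-Reasoning

-- Residues modulo a prime

legendre-∣ : ∀ {a q} → q ∣ a → legendre a q ≡ 0ℤ
legendre-∣ {a} {q} q∣a rewrite dec-true (q ∣? a) q∣a = refl

legendre-∤ : ∀ {a q} → q ∤ a → legendre a q ≡ (if isQR a q then 1ℤ else -1ℤ)
legendre-∤ {a} {q} q∤a rewrite dec-false (q ∣? a) q∤a = refl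

module _ (n : ℕ) where

  open Modulo (suc n)

  isQR⇒square : ∀ {a} → T (isQR a (suc n)) → ∃[ x ] x * x ≈ a
  isQR⇒square {a} qr with x , x²%n≡a%n ← satisfied (any⁻ _ (upTo (suc n)) qr) =
    x , mk≈ (≡ᵇ⇒≡ _ _ x²%n≡a%n)

  square⇒isQR : ∀ {a x} → x * x ≈ a → T (isQR a (suc n))
  square⇒isQR {a} {x} (mk≈ x²%n≡a%n) = any⁺ _ (lose (∈-upTo⁺ (m%n<n x (suc n)))
    (≡⇒≡ᵇ _ _ (trans (sym (%-distribˡ-* x x (suc n))) x²%n≡a%n)))

legendre-QR : ∀ {a q} → q ∤ a → T (isQR a q) → legendre a q ≡ 1ℤ
legendre-QR {a} {q} q∤a qr rewrite legendre-∤ q∤a with isQR a q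
... | true = refl

module PrimeModulus (m : ℕ) (p-prime : Prime (suc m)) where

  p : ℕ
  p = suc m

  open Modulo p public
  open FoldMap *-commutativeMonoid using (foldMap-cong)

  residues : List ℕ
  residues = segment 0 m

  1≤m : 1 ≤ m
  1≤m = n≢0⇒n>0 λ { refl → ¬prime[1] p-prime }

  p∤1 : p ∤ 1
  p∤1 p∣1 = <⇒≱ (s≤s 1≤m) (∣⇒≤ p∣1)

  p∤* : ∀ {x y} → p ∤ x → p ∤ y → p ∤ x * y
  p∤* p∤x p∤y p∣xy with euclidsLemma _ _ p-prime p∣xy
  ... | inj₁ p∣x = p∤x p∣x
  ... | inj₂ p∣y = p∤y p∣y

  p∤product : ∀ {xs} → All (p ∤_) xs → p ∤ product xs
  p∤product []             = p∤1
  p∤product (p∤x ∷ p∤xs) = p∤* p∤x (p∤product p∤xs)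

  0<x<p⇒p∤x : ∀ {x} → 0 < x → x < p → p ∤ x
  0<x<p⇒p∤x {suc x} _ x<p p∣x = <⇒≱ x<p (∣⇒≤ p∣x)

  residue<p : ∀ {x} → x ∈ residues → x < p
  residue<p x∈ = s≤s (proj₂ (∈-segment⁻ x∈))

  residue⇒p∤ : ∀ {x} → x ∈ residues → p ∤ x
  residue⇒p∤ x∈ = 0<x<p⇒p∤x (proj₁ (∈-segment⁻ x∈)) (residue<p x∈)

  p∤⇒%-residue : ∀ {x} → p ∤ x → x % p ∈ residues
  p∤⇒%-residue {x} p∤x =
    ∈-segment⁺ (n≢0⇒n>0 (λ x%p≡0 → p∤x (≈0⇒∣ (mk≈ x%p≡0)))) (≤-pred (m%n<n x p))

  private
    *-cancelʳ-≈-≥ : ∀ {x y z} → p ∤ z → y ≤ x → x * z ≈ y * z → x ≈ y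
    *-cancelʳ-≈-≥ {x} {y} {z} p∤z y≤x xz≈yz
      with euclidsLemma (x ∸ y) z p-prime
             (subst (p ∣_) (sym (*-distribʳ-∸ z x y)) (≈⇒∣∸ (*-monoˡ-≤ z y≤x) xz≈yz))
    ... | inj₁ p∣x∸y = ∣∸⇒≈ y≤x p∣x∸y
    ... | inj₂ p∣z   = contradiction p∣z p∤z

  *-cancelʳ-≈ : ∀ {x y z} → p ∤ z → x * z ≈ y * z → x ≈ y
  *-cancelʳ-≈ {x} {y} p∤z xz≈yz with ≤-total y x
  ... | inj₁ y≤x = *-cancelʳ-≈-≥ p∤z y≤x xz≈yz
  ... | inj₂ x≤y = ≈-sym (*-cancelʳ-≈-≥ p∤z x≤y (≈-sym xz≈yz))

  *-cancelˡ-≈ : ∀ {x y z} → p ∤ z → z * x ≈ z * y → x ≈ y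
  *-cancelˡ-≈ {x} {y} {z} p∤z zx≈zy =
    *-cancelʳ-≈ p∤z (≈-trans (≡⇒≈ (*-comm x z)) (≈-trans zx≈zy (≡⇒≈ (*-comm z y))))

  residue-≈⇒≡ : ∀ {x y} → x ∈ residues → y ∈ residues → x ≈ y → x ≡ y
  residue-≈⇒≡ x∈ y∈ = ≈⇒≡ (residue<p x∈) (residue<p y∈)

  *-permutes-residues : ∀ {a} → p ∤ a → map (λ k → a * k % p) residues ↭ residues
  *-permutes-residues {a} p∤a =
    injective-selfMap⇒↭ (segment-unique 0 m) (λ k∈ → p∤⇒%-residue (p∤* p∤a (residue⇒p∤ k∈)))
      (λ x∈ y∈ ax%p≡ay%p → residue-≈⇒≡ x∈ y∈ (*-cancelˡ-≈ p∤a (mk≈ ax%p≡ay%p)))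

  ∃-quotient : ∀ {x c} → p ∤ x → p ∤ c → ∃[ y ] y ∈ residues × x * y ≈ c
  ∃-quotient {x} p∤x p∤c
    with y , y∈ , c%p≡xy%p ← ∈-map⁻ (λ k → x * k % p)
                               (∈-resp-↭ (↭-sym (*-permutes-residues p∤x)) (p∤⇒%-residue p∤c))
    = y , y∈ , mk≈ (sym c%p≡xy%p)

  fermat : ∀ {a} → p ∤ a → a ^ m ≈ 1
  fermat {a} p∤a = *-cancelʳ-≈ (p∤product (All.tabulate residue⇒p∤)) (begin
    a ^ m * product residues                  ≡⟨ cong (λ l → a ^ l * product residues) (length-segment 0 m) ⟨
    a ^ length residues * product residues    ≡⟨ product-map-*ˡ a residues ⟨
    product (map (a *_) residues)             ≈⟨ foldMap-cong residues (λ _ → %-≈ _) ⟨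
    product (map (λ k → a * k % p) residues)  ≡⟨ product-↭ (*-permutes-residues p∤a) ⟩
    product residues                          ≡⟨ *-identityˡ _ ⟨
    1 * product residues                      ∎)
    where open import Relation.Binary.Reasoning.Setoid ≈-setoid

  x²≈1⇒x≡±1 : ∀ {x} → x < p → x * x ≈ 1 → x ≡ 1 ⊎ x ≡ m
  x²≈1⇒x≡±1 {zero}  _   (mk≈ 0≡1%p) = contradiction (trans 0≡1%p (m<n⇒m%n≡m (s≤s 1≤m))) λ ()
  x²≈1⇒x≡±1 {suc x} x<p x²≈1 with euclidsLemma x (2 + x) p-prime p∣x[2+x]
    where
    p∣x[2+x] : p ∣ x * (2 + x)
    p∣x[2+x] = subst (p ∣_) (cong (_∸ 1) ([1+n]²≡1+n[2+n] x))
                 (≈⇒∣∸ (subst (1 ≤_) (sym ([1+n]²≡1+n[2+n] x)) (s≤s z≤n)) x²≈1)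
  ... | inj₁ p∣x = inj₁ (cong suc (≈⇒≡ (<-trans (n<1+n x) x<p) z<s (∣⇒≈0 p∣x)))
  ... | inj₂ p∣2+x = inj₂ (suc-injective (≤-antisym x<p (∣⇒≤ p∣2+x)))

  m²≈1 : m * m ≈ 1
  m²≈1 = mk≈ (begin
    m * m % p                                  ≡⟨ cong (λ n → n * n % p) 1+[m-1]≡m ⟨
    suc (pred m) * suc (pred m) % p            ≡⟨ cong (_% p) ([1+n]²≡1+n[2+n] (pred m)) ⟩
    (1 + pred m * suc (suc (pred m))) % p      ≡⟨ cong (λ n → (1 + pred m * suc n) % p) 1+[m-1]≡m ⟩
    (1 + pred m * p) % p                       ≡⟨ [m+kn]%n≡m%n 1 (pred m) p ⟩
    1 % p                                      ∎)
    where
    open ≡-Reasoning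
    1+[m-1]≡m : suc (pred m) ≡ m
    1+[m-1]≡m = suc-pred m {{>-nonZero 1≤m}}

  residue-*-cancelʳ : ∀ {x y z} → x ∈ residues → y ∈ residues → z ∈ residues → x * y ≈ z * y → x ≡ z
  residue-*-cancelʳ x∈ y∈ z∈ xy≈zy = residue-≈⇒≡ x∈ z∈ (*-cancelʳ-≈ (residue⇒p∤ y∈) xy≈zy)

  inverse-avoids-±1 : ∀ {y z} → z ∈ residues → y ∈ residues → z * y ≈ 1 → 1 < z → z < m →
                      1 < y × y < m × y ≢ z
  inverse-avoids-±1 {y} {z} z∈ y∈ zy≈1 1<z z<m =
    ≤∧≢⇒< (proj₁ (∈-segment⁻ y∈)) (y≢1 ∘ sym) , ≤∧≢⇒< (proj₂ (∈-segment⁻ y∈)) y≢m , y≢z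
    where
    m∈residues : m ∈ residues
    m∈residues = ∈-segment⁺ 1≤m ≤-refl
    y≢1 : y ≢ 1
    y≢1 refl = <⇒≢ 1<z (sym (≈⇒≡ (residue<p z∈) (s≤s 1≤m) (≈-trans (≡⇒≈ (sym (*-identityʳ z))) zy≈1)))
    y≢m : y ≢ m
    y≢m refl = <⇒≢ z<m (residue-*-cancelʳ z∈ m∈residues m∈residues (≈-trans zy≈1 (≈-sym m²≈1)))
    y≢z : y ≢ z
    y≢z refl with x²≈1⇒x≡±1 (residue<p z∈) zy≈1
    ... | inj₁ z≡1 = <⇒≢ 1<z (sym z≡1)
    ... | inj₂ z≡m = <⇒≢ z<m z≡m

  Paired : ℕ → List ℕ → Set
  Paired c xs = ∀ {x} → x ∈ xs → ∃[ y ] y ∈ xs × y ≢ x × x * y ≈ c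

  Paired-dropPair : ∀ {c x y} as {bs} → let xs = x ∷ as ++ y ∷ bs in
                    Unique xs → xs ⊆ residues → x * y ≈ c → Paired c xs → Paired c (as ++ bs)
  Paired-dropPair {c} {x} {y} as {bs} (x∉ ∷ uxs) xs⊆ xy≈c partner = partner′
    where
    widen = ⊆-insertMiddle as
    x∈residues = xs⊆ (here refl)
    y∈residues = xs⊆ (there (∈-insert as))
    partner′ : Paired c (as ++ bs)
    partner′ {z} z∈ with partner (there (widen z∈))
    ... | w , here refl , _ , zx≈c = contradiction (subst (_∈ as ++ bs) z≡y z∈) (proj₁ (Unique-dropMiddle as uxs))
      where
      z≡y : z ≡ y
      z≡y = residue-*-cancelʳ (xs⊆ (there (widen z∈))) x∈residues y∈residues
              (≈-trans zx≈c (≈-trans (≈-sym xy≈c) (≡⇒≈ (*-comm x y))))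
    ... | w , there w∈ , w≢z , zw≈c with w ≟ y
    ...   | no  w≢y  = w , ∈-dropMiddle as w∈ w≢y , w≢z , zw≈c
    ...   | yes refl = contradiction (widen (subst (_∈ as ++ bs) z≡x z∈)) (λ x∈ → All.lookup x∉ x∈ refl)
      where
      z≡x : z ≡ x
      z≡x = residue-*-cancelʳ (xs⊆ (there (widen z∈))) y∈residues x∈residues (≈-trans zw≈c (≈-sym xy≈c))

  pairing : ∀ c {xs} → Unique xs → xs ⊆ residues → Paired c xs → ∃[ k ] length xs ≡ k + k × product xs ≈ c ^ k
  pairing c = go _ ≤-refl
    where
    go : ∀ n {xs} → length xs ≤ n → Unique xs → xs ⊆ residues → Paired c xs →
         ∃[ k ] length xs ≡ k + k × product xs ≈ c ^ k
    go _       {[]}     _ _ _ _ = 0 , refl , ≈-refl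
    go (suc n) {x ∷ xs} (s≤s |xs|≤n) u@(_ ∷ uxs) xs⊆ partner with partner (here refl)
    ... | y , here refl , y≢x , _  = contradiction refl y≢x
    ... | y , there y∈xs , _ , xy≈c with as , bs , refl ← ∈-∃++ y∈xs =
      extend (go n |as++bs|≤n (proj₂ (Unique-dropMiddle as uxs)) (xs⊆ ∘ there ∘ ⊆-insertMiddle as)
                 (Paired-dropPair as u xs⊆ xy≈c partner))
      where
      open import Relation.Binary.Reasoning.Setoid ≈-setoid
      |as++bs|≤n : length (as ++ bs) ≤ n
      |as++bs|≤n = ≤-trans (n≤1+n _) (subst (_≤ n) (length-dropMiddle as) |xs|≤n)
      extend : ∃[ k ] length (as ++ bs) ≡ k + k × product (as ++ bs) ≈ c ^ k →
               ∃[ k ] length (x ∷ as ++ y ∷ bs) ≡ k + k × product (x ∷ as ++ y ∷ bs) ≈ c ^ k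
      extend (k , |as++bs|≡k+k , Πas++bs≈cᵏ) =
        suc k ,
        cong suc (trans (length-dropMiddle as) (trans (cong suc |as++bs|≡k+k) (sym (+-suc k k)))) ,
        (begin
          x * product (as ++ y ∷ bs)   ≡⟨ cong (x *_) (product-↭ (shift y as bs)) ⟩
          x * (y * product (as ++ bs)) ≡⟨ *-assoc x y _ ⟨
          x * y * product (as ++ bs)   ≈⟨ *-cong xy≈c Πas++bs≈cᵏ ⟩
          c * c ^ k                    ∎)

-- Euler's criterion and the lemmas of Gauss and Eisenstein

module OddPrimeModulus (h : ℕ) (p-prime : Prime (suc (h + h))) where

  open PrimeModulus (h + h) p-prime public

  -- p-1 represents -1 modulo p; the sign -1ℤ ^ e corresponds to the residue p-1 ^ e.
  p-1 : ℕ
  p-1 = h + h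

  1≤h : 1 ≤ h
  1≤h = n≢0⇒n>0 λ { refl → ¬prime[1] p-prime }

  2≤p-1 : 2 ≤ p-1
  2≤p-1 = +-mono-≤ 1≤h 1≤h

  1≉p-1 : ¬ 1 ≈ p-1
  1≉p-1 1≈p-1 = <⇒≢ 2≤p-1 (≈⇒≡ (s≤s 1≤m) ≤-refl 1≈p-1)

  p-1^≈±1 : ∀ e → (-1ℤ ℤ.^ e ≡ 1ℤ × p-1 ^ e ≈ 1) ⊎ (-1ℤ ℤ.^ e ≡ -1ℤ × p-1 ^ e ≈ p-1)
  p-1^≈±1 zero    = inj₁ (refl , ≈-refl)
  p-1^≈±1 (suc e) with p-1^≈±1 e
  ... | inj₁ (-1ᵉ≡1 , p-1ᵉ≈1)   =
    inj₂ (cong (-1ℤ ℤ.*_) -1ᵉ≡1 , ≈-trans (*-congˡ p-1 p-1ᵉ≈1) (≡⇒≈ (*-identityʳ p-1)))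
  ... | inj₂ (-1ᵉ≡-1 , p-1ᵉ≈p-1) =
    inj₁ (cong (-1ℤ ℤ.*_) -1ᵉ≡-1 , ≈-trans (*-congˡ p-1 p-1ᵉ≈p-1) m²≈1)

  p-1^-injective : ∀ e f → p-1 ^ e ≈ p-1 ^ f → -1ℤ ℤ.^ e ≡ -1ℤ ℤ.^ f
  p-1^-injective e f p-1ᵉ≈p-1ᶠ with p-1^≈±1 e | p-1^≈±1 f
  ... | inj₁ (-1ᵉ≡1 , _)    | inj₁ (-1ᶠ≡1 , _)    = trans -1ᵉ≡1 (sym -1ᶠ≡1)
  ... | inj₂ (-1ᵉ≡-1 , _)   | inj₂ (-1ᶠ≡-1 , _)   = trans -1ᵉ≡-1 (sym -1ᶠ≡-1)
  ... | inj₁ (_ , p-1ᵉ≈1)   | inj₂ (_ , p-1ᶠ≈p-1) =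
    contradiction (≈-trans (≈-sym p-1ᵉ≈1) (≈-trans p-1ᵉ≈p-1ᶠ p-1ᶠ≈p-1)) 1≉p-1
  ... | inj₂ (_ , p-1ᵉ≈p-1) | inj₁ (_ , p-1ᶠ≈1)   =
    contradiction (≈-trans (≈-sym p-1ᶠ≈1) (≈-trans (≈-sym p-1ᵉ≈p-1ᶠ) p-1ᵉ≈p-1)) 1≉p-1

  -- 1 and p-1 are their own inverses; the other residues pair off with their inverses.
  wilson : product residues ≈ p-1
  wilson = begin
    product (segment 0 p-1)                    ≡⟨ cong (product ∘ segment 0) p-1≡2+k ⟩
    (2 + k) * product (segment 0 (suc k))      ≡⟨ cong (λ xs → (2 + k) * product xs) (segment-∷ʳ 0 k) ⟩
    (2 + k) * product (segment 1 k ++ 1 ∷ [])  ≡⟨ cong ((2 + k) *_) (product-++ (segment 1 k) (1 ∷ [])) ⟩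
    (2 + k) * (product (segment 1 k) * 1)      ≈⟨ *-congˡ (2 + k) (*-congʳ 1 Πinner≈1) ⟩
    (2 + k) * 1                                ≡⟨ *-identityʳ (2 + k) ⟩
    2 + k                                      ≡⟨ p-1≡2+k ⟨
    p-1                                        ∎
    where
    open import Relation.Binary.Reasoning.Setoid ≈-setoid
    k = p-1 ∸ 2
    p-1≡2+k : p-1 ≡ 2 + k
    p-1≡2+k = sym (m+[n∸m]≡n 2≤p-1)
    inner⊆residues : segment 1 k ⊆ residues
    inner⊆residues z∈ with 1<z , z≤1+k ← ∈-segment⁻ z∈ =
      ∈-segment⁺ (<⇒≤ 1<z) (≤-trans (n≤1+n _) (≤-trans (s≤s z≤1+k) (≤-reflexive (sym p-1≡2+k))))
    inverse-in-inner : Paired 1 (segment 1 k)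
    inverse-in-inner {z} z∈
      with 1<z , z≤1+k ← ∈-segment⁻ z∈
      with y , y∈ , zy≈1 ← ∃-quotient (residue⇒p∤ (inner⊆residues z∈)) p∤1
      with 1<y , y<p-1 , y≢z ← inverse-avoids-±1 (inner⊆residues z∈) y∈ zy≈1 1<z
                                 (subst (z <_) (sym p-1≡2+k) (s≤s z≤1+k))
      = y , ∈-segment⁺ 1<y (≤-pred (subst (y <_) p-1≡2+k y<p-1)) , y≢z , zy≈1
    Πinner≈1 : product (segment 1 k) ≈ 1
    Πinner≈1 with j , _ , Π≈1ʲ ← pairing 1 (segment-unique 1 k) inner⊆residues inverse-in-inner =
      ≈-trans Π≈1ʲ (≡⇒≈ (^-zeroˡ j))

  euler-residue : ∀ {a} → p ∤ a → T (isQR a p) → a ^ h ≈ 1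
  euler-residue {a} p∤a qr with x , x²≈a ← isQR⇒square (h + h) qr = begin
    a ^ h             ≈⟨ ^-congˡ h x²≈a ⟨
    (x * x) ^ h       ≡⟨ cong (λ y → (x * y) ^ h) (*-identityʳ x) ⟨
    (x ^ 2) ^ h       ≡⟨ ^-*-assoc x 2 h ⟩
    x ^ (2 * h)       ≡⟨ cong (λ n → x ^ (h + n)) (+-identityʳ h) ⟩
    x ^ p-1           ≈⟨ fermat p∤x ⟩
    1                 ∎
    where
    open import Relation.Binary.Reasoning.Setoid ≈-setoid
    p∤x : p ∤ x
    p∤x p∣x = p∤a (≈0⇒∣ (≈-trans (≈-sym x²≈a) (∣⇒≈0 (∣m⇒∣m*n x p∣x))))

  euler-nonresidue : ∀ {a} → p ∤ a → ¬ T (isQR a p) → a ^ h ≈ p-1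
  -- Pairing x with a / x: no residue is its own partner because a is not a square.
  euler-nonresidue {a} p∤a non-qr = conclude (pairing a (segment-unique 0 p-1) (λ x∈ → x∈) partner)
    where
    partner : Paired a residues
    partner x∈ with y , y∈ , xy≈a ← ∃-quotient (residue⇒p∤ x∈) p∤a =
      y , y∈ , (λ { refl → non-qr (square⇒isQR (h + h) {x = y} xy≈a) }) , xy≈a
    conclude : ∃[ k ] length residues ≡ k + k × product residues ≈ a ^ k → a ^ h ≈ p-1
    conclude (k , |residues|≡k+k , Πresidues≈aᵏ) =
      ≈-trans (subst (λ j → a ^ j ≈ product residues) k≡h (≈-sym Πresidues≈aᵏ)) wilson
      where
      k≡h : k ≡ h
      k≡h = +-double-injective (trans (sym |residues|≡k+k) (length-segment 0 p-1))

  euler-criterion : ∀ {a} → p ∤ a → ∃[ e ] legendre a p ≡ -1ℤ ℤ.^ e × a ^ h ≈ p-1 ^ e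
  euler-criterion {a} p∤a rewrite legendre-∤ p∤a with isQR a p in qr
  ... | true  = 0 , refl , euler-residue p∤a (subst T (sym qr) tt)
  ... | false = 1 , refl , ≈-trans (euler-nonresidue p∤a (subst T qr)) (≡⇒≈ (sym (*-identityʳ p-1)))

  legendre-by-power : ∀ {a} e → p ∤ a → a ^ h ≈ p-1 ^ e → legendre a p ≡ -1ℤ ℤ.^ e
  legendre-by-power e p∤a aʰ≈p-1ᵉ with f , legendre≡ , aʰ≈p-1ᶠ ← euler-criterion p∤a =
    trans legendre≡ (p-1^-injective f e (≈-trans (≈-sym aʰ≈p-1ᶠ) aʰ≈p-1ᵉ))

  legendre-* : ∀ x y → legendre (x * y) p ≡ legendre x p ℤ.* legendre y p
  legendre-* x y with p ∣? x | p ∣? y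
  ... | yes p∣x | _ = begin
    legendre (x * y) p             ≡⟨ legendre-∣ (∣m⇒∣m*n y p∣x) ⟩
    0ℤ                             ≡⟨ ℤ.*-zeroˡ (legendre y p) ⟨
    0ℤ ℤ.* legendre y p            ≡⟨ cong (ℤ._* legendre y p) (legendre-∣ p∣x) ⟨
    legendre x p ℤ.* legendre y p  ∎
    where open ≡-Reasoning
  ... | no _ | yes p∣y = begin
    legendre (x * y) p             ≡⟨ legendre-∣ (∣n⇒∣m*n x p∣y) ⟩
    0ℤ                             ≡⟨ ℤ.*-zeroʳ (legendre x p) ⟨
    legendre x p ℤ.* 0ℤ            ≡⟨ cong (legendre x p ℤ.*_) (legendre-∣ p∣y) ⟨
    legendre x p ℤ.* legendre y p  ∎
    where open ≡-Reasoning
  ... | no p∤x | no p∤y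
    with e , legendre-x , xʰ≈ ← euler-criterion p∤x
       | f , legendre-y , yʰ≈ ← euler-criterion p∤y = begin
    legendre (x * y) p             ≡⟨ legendre-by-power (e + f) (p∤* p∤x p∤y) [xy]ʰ≈p-1ᵉ⁺ᶠ ⟩
    -1ℤ ℤ.^ (e + f)                ≡⟨ ℤ.^-distribˡ-+-* -1ℤ e f ⟩
    -1ℤ ℤ.^ e ℤ.* -1ℤ ℤ.^ f        ≡⟨ cong₂ ℤ._*_ legendre-x legendre-y ⟨
    legendre x p ℤ.* legendre y p  ∎
    where
    open ≡-Reasoning
    [xy]ʰ≈p-1ᵉ⁺ᶠ : (x * y) ^ h ≈ p-1 ^ (e + f)
    [xy]ʰ≈p-1ᵉ⁺ᶠ = ≈-trans (≡⇒≈ (^-distribʳ-* x y h))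
                   (≈-trans (*-cong xʰ≈ yʰ≈) (≡⇒≈ (sym (^-distribˡ-+-* p-1 e f))))

  p-1*r≈p∸r : ∀ {r} → r ≤ p → p-1 * r ≈ p ∸ r
  p-1*r≈p∸r {zero}  _   = mk≈ (trans (cong (_% p) (*-zeroʳ p-1)) (sym (n%n≡0 p)))
  p-1*r≈p∸r {suc r} r<p = mk≈ (trans (cong (_% p) p-1*[1+r]≡q+r*p) ([m+kn]%n≡m%n q r p))
    where
    q = p ∸ suc r
    p≡1+r+q : p ≡ suc (r + q)
    p≡1+r+q = sym (m+[n∸m]≡n r<p)
    identity : ∀ r q → (r + q) * suc r ≡ q + r * suc (r + q)
    identity = solve-∀
    p-1*[1+r]≡q+r*p : p-1 * suc r ≡ q + r * p
    p-1*[1+r]≡q+r*p = trans (cong (_* suc r) (suc-injective p≡1+r+q))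
                            (trans (identity r q) (cong (λ n → q + r * n) (sym p≡1+r+q)))

  -- For 0 < r < p, the representative of r in [-h, h] is ± minAbs r, negative iff exceedsHalf r ≡ 1.
  minAbs : ℕ → ℕ
  minAbs r with r ≤? h
  ... | yes _ = r
  ... | no  _ = p ∸ r

  exceedsHalf : ℕ → ℕ
  exceedsHalf r with r ≤? h
  ... | yes _ = 0
  ... | no  _ = 1

  minAbs-∈ : ∀ {r} → r ∈ residues → minAbs r ∈ segment 0 h
  minAbs-∈ {r} r∈ with r ≤? h
  ... | yes r≤h = ∈-segment⁺ (proj₁ (∈-segment⁻ r∈)) r≤h
  ... | no  r≰h = ∈-segment⁺ (m<n⇒0<n∸m (residue<p r∈))
                    (≤-trans (∸-monoʳ-≤ p (≰⇒> r≰h)) (≤-reflexive (m+n∸m≡n h h)))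

  minAbs-≡ : ∀ {r s} → r ≤ p → s ≤ p → minAbs r ≡ minAbs s → r ≡ s ⊎ r + s ≡ p
  minAbs-≡ {r} {s} r≤p s≤p eq with r ≤? h | s ≤? h
  ... | yes _ | yes _ = inj₁ eq
  ... | yes _ | no  _ = inj₂ (trans (cong (_+ s) eq) (m∸n+n≡m s≤p))
  ... | no  _ | yes _ = inj₂ (trans (cong (r +_) (sym eq)) (m+[n∸m]≡n r≤p))
  ... | no  _ | no  _ = inj₁ (∸-cancelˡ-≡ r≤p s≤p eq)

  minAbs-≈ : ∀ {r} → r ≤ p → minAbs r ≈ p-1 ^ exceedsHalf r * r
  minAbs-≈ {r} r≤p with r ≤? h
  ... | yes _ = ≡⇒≈ (sym (*-identityˡ r))
  ... | no  _ = ≈-trans (≈-sym (p-1*r≈p∸r r≤p)) (≡⇒≈ (cong (_* r) (sym (*-identityʳ p-1))))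

  minAbs-parity : ∀ {r} → r ≤ p → r + minAbs r ≡₂ exceedsHalf r
  minAbs-parity {r} r≤p with r ≤? h
  ... | yes _ = n+n≡₂0 r
  ... | no  _ = Parity.≈-trans (Parity.≡⇒≈ (m+[n∸m]≡n r≤p)) (1+n+n≡₂1 h)

  half⊆residues : segment 0 h ⊆ residues
  half⊆residues k∈ with 0<k , k≤h ← ∈-segment⁻ k∈ = ∈-segment⁺ 0<k (≤-trans k≤h (m≤m+n h h))

  minAbs-permutes : ∀ {a} → p ∤ a → map (λ k → minAbs (a * k % p)) (segment 0 h) ↭ segment 0 h
  minAbs-permutes {a} p∤a = injective-selfMap⇒↭ (segment-unique 0 h) (minAbs-∈ ∘ ak%p∈) injective
    where
    ak%p∈ : ∀ {k} → k ∈ segment 0 h → a * k % p ∈ residues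
    ak%p∈ k∈ = p∤⇒%-residue (p∤* p∤a (residue⇒p∤ (half⊆residues k∈)))
    injective : InjectiveOn (λ k → minAbs (a * k % p)) (segment 0 h)
    injective {i} {j} i∈ j∈ eq with minAbs-≡ (<⇒≤ (m%n<n (a * i) p)) (<⇒≤ (m%n<n (a * j) p)) eq
    ... | inj₁ ai%p≡aj%p =
      residue-≈⇒≡ (half⊆residues i∈) (half⊆residues j∈) (*-cancelˡ-≈ p∤a (mk≈ ai%p≡aj%p))
    ... | inj₂ ai%p+aj%p≡p with euclidsLemma a (i + j) p-prime (≈0⇒∣ a[i+j]≈0)
      where
      a[i+j]≈0 : a * (i + j) ≈ 0
      a[i+j]≈0 = ≈-trans (≡⇒≈ (*-distribˡ-+ a i j))
                 (≈-trans (+-cong (≈-sym (%-≈ (a * i))) (≈-sym (%-≈ (a * j))))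
                 (≈-trans (≡⇒≈ ai%p+aj%p≡p) (∣⇒≈0 ∣-refl)))
    ...   | inj₁ p∣a   = contradiction p∣a p∤a
    ...   | inj₂ p∣i+j = contradiction p∣i+j (0<x<p⇒p∤x 0<i+j (s≤s (+-mono-≤ i≤h j≤h)))
      where
      0<i+j = ≤-trans (proj₁ (∈-segment⁻ i∈)) (m≤m+n i j)
      i≤h = proj₂ (∈-segment⁻ i∈)
      j≤h = proj₂ (∈-segment⁻ j∈)

  gaussCount : ℕ → ℕ
  gaussCount a = sum (map (λ k → exceedsHalf (a * k % p)) (segment 0 h))

  p-1^e*p-1^e≈1 : ∀ e → p-1 ^ e * p-1 ^ e ≈ 1
  p-1^e*p-1^e≈1 e with p-1^≈±1 e
  ... | inj₁ (_ , p-1ᵉ≈1)   = *-cong p-1ᵉ≈1 p-1ᵉ≈1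
  ... | inj₂ (_ , p-1ᵉ≈p-1) = ≈-trans (*-cong p-1ᵉ≈p-1 p-1ᵉ≈p-1) m²≈1

  gauss-lemma : ∀ {a} → p ∤ a → legendre a p ≡ -1ℤ ℤ.^ gaussCount a
  gauss-lemma {a} p∤a = legendre-by-power μ p∤a (begin
    a ^ h                        ≡⟨ *-identityˡ (a ^ h) ⟨
    1 * a ^ h                    ≈⟨ *-congʳ (a ^ h) (p-1^e*p-1^e≈1 μ) ⟨
    p-1 ^ μ * p-1 ^ μ * a ^ h    ≡⟨ *-assoc (p-1 ^ μ) _ _ ⟩
    p-1 ^ μ * (p-1 ^ μ * a ^ h)  ≈⟨ *-congˡ (p-1 ^ μ) p-1^μ*aʰ≈1 ⟩
    p-1 ^ μ * 1                  ≡⟨ *-identityʳ _ ⟩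
    p-1 ^ μ                      ∎)
    where
    open import Relation.Binary.Reasoning.Setoid ≈-setoid
    open FoldMap *-commutativeMonoid using (foldMap-cong)
    μ = gaussCount a
    half = segment 0 h
    sign : ℕ → ℕ
    sign k = p-1 ^ exceedsHalf (a * k % p)
    p-1^μ*aʰ≈1 : p-1 ^ μ * a ^ h ≈ 1
    p-1^μ*aʰ≈1 = *-cancelʳ-≈ (p∤product (All.tabulate (residue⇒p∤ ∘ half⊆residues))) (begin
      p-1 ^ μ * a ^ h * product half                          ≡⟨ *-assoc (p-1 ^ μ) _ _ ⟩
      p-1 ^ μ * (a ^ h * product half)                        ≡⟨ cong₂ _*_
        (foldMap-homo +-0-commutativeMonoid *-1-commutativeMonoid (^-isMonoidHomomorphism p-1) _ half)
        (trans (cong (λ l → a ^ l * product half) (sym (length-segment 0 h))) (sym (product-map-*ˡ a half))) ⟩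
      product (map sign half) * product (map (a *_) half)     ≡⟨ Product.foldMap-∙ sign (a *_) half ⟨
      product (map (λ k → sign k * (a * k)) half)             ≈⟨ foldMap-cong half (λ {k} _ →
        ≈-trans (*-congˡ (sign k) (≈-sym (%-≈ (a * k)))) (≈-sym (minAbs-≈ (<⇒≤ (m%n<n (a * k) p))))) ⟩
      product (map (λ k → minAbs (a * k % p)) half)           ≡⟨ product-↭ (minAbs-permutes p∤a) ⟩
      product half                                            ≡⟨ *-identityˡ _ ⟨
      1 * product half                                        ∎)

  eisensteinSum : ℕ → ℕ
  eisensteinSum a = sum (map (λ k → a * k / p) (segment 0 h))

  gaussCount≡₂eisensteinSum : ∀ {a} → a ≡₂ 1 → p ∤ a → gaussCount a ≡₂ eisensteinSum a
  gaussCount≡₂eisensteinSum {a} a≡₂1 p∤a = begin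
    gaussCount a                      ≈⟨ Sum₂.foldMap-cong half (λ {k} _ → minAbs-parity (r≤p k)) ⟨
    sum (map (λ k → r k + s k) half)  ≡⟨ Sum.foldMap-∙ r s half ⟩
    R + sum (map s half)              ≡⟨ cong (R +_) (sum-↭ (minAbs-permutes p∤a)) ⟩
    R + sum half                      ≈⟨ Parity.+-congˡ R T≡₂R+S ⟩
    R + (R + S)                       ≡⟨ +-assoc R R S ⟨
    R + R + S                         ≈⟨ Parity.+-congʳ S (n+n≡₂0 R) ⟩
    S                                 ∎
    where
    open import Relation.Binary.Reasoning.Setoid Parity.≈-setoid
    module Sum₂ = FoldMap Parity.+-commutativeMonoid
    half = segment 0 h
    r s q : ℕ → ℕ
    r k = a * k % p
    s k = minAbs (r k)
    q k = a * k / p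
    R = sum (map r half)
    S = eisensteinSum a
    r≤p : ∀ k → r k ≤ p
    r≤p k = <⇒≤ (m%n<n (a * k) p)
    k≡₂r+q : ∀ k → k ≡₂ r k + q k
    k≡₂r+q k = begin
      k               ≡⟨ *-identityˡ k ⟨
      1 * k           ≈⟨ Parity.*-congʳ k a≡₂1 ⟨
      a * k           ≡⟨ m≡m%n+[m/n]*n (a * k) p ⟩
      r k + q k * p   ≈⟨ Parity.+-congˡ (r k) (Parity.*-congˡ (q k) (1+n+n≡₂1 h)) ⟩
      r k + q k * 1   ≡⟨ cong (r k +_) (*-identityʳ (q k)) ⟩
      r k + q k       ∎
    T≡₂R+S : sum half ≡₂ R + S
    T≡₂R+S = begin
      sum half                           ≡⟨ cong sum (map-id half) ⟨
      sum (map (λ k → k) half)           ≈⟨ Sum₂.foldMap-cong half (λ {k} _ → k≡₂r+q k) ⟩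
      sum (map (λ k → r k + q k) half)   ≡⟨ Sum.foldMap-∙ r q half ⟩
      R + S                              ∎

  eisenstein-lemma : ∀ {a} → a ≡₂ 1 → p ∤ a → legendre a p ≡ -1ℤ ℤ.^ eisensteinSum a
  eisenstein-lemma a≡₂1 p∤a = trans (gauss-lemma p∤a) (-1^-cong (gaussCount≡₂eisensteinSum a≡₂1 p∤a))

-- Quadratic reciprocity

𝟙[_≤_] : ℕ → ℕ → ℕ
𝟙[ x ≤ y ] with x ≤? y
... | yes _ = 1
... | no  _ = 0

𝟙≤-dichotomy : ∀ {x y} → x ≢ y → 𝟙[ x ≤ y ] + 𝟙[ y ≤ x ] ≡ 1
𝟙≤-dichotomy {x} {y} x≢y with x ≤? y | y ≤? x
... | yes x≤y | yes y≤x = contradiction (≤-antisym x≤y y≤x) x≢y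
... | yes _   | no  _   = refl
... | no  _   | yes _   = refl
... | no  x≰y | no  y≰x = contradiction (≰⇒≥ x≰y) y≰x

*≤⇒≤/ : ∀ d .{{_ : NonZero d}} {k N} → d * k ≤ N → k ≤ N / d
*≤⇒≤/ d {k} {N} dk≤N =
  ≤-trans (≤-reflexive (sym (m*n/n≡m k d))) (/-monoˡ-≤ d (subst (_≤ N) (*-comm d k) dk≤N))

≤/⇒*≤ : ∀ d .{{_ : NonZero d}} {k N} → k ≤ N / d → d * k ≤ N
≤/⇒*≤ d {k} {N} k≤N/d = ≤-trans (subst (_≤ N / d * d) (*-comm k d) (*-monoˡ-≤ d k≤N/d)) (m/n*n≤m N d)

count-multiples : ∀ d .{{_ : NonZero d}} N m →
                  sum (map (λ j → 𝟙[ d * j ≤ N ]) (segment 0 m)) ≡ m ⊓ (N / d)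
count-multiples d N zero    = refl
count-multiples d N (suc m) with d * suc m ≤? N
... | yes d[1+m]≤N =
  trans (cong suc (trans (count-multiples d N m) (m≤n⇒m⊓n≡m (≤-trans (n≤1+n m) 1+m≤N/d))))
        (sym (m≤n⇒m⊓n≡m 1+m≤N/d))
  where 1+m≤N/d = *≤⇒≤/ d d[1+m]≤N
... | no  d[1+m]≰N =
  trans (trans (count-multiples d N m) (m≥n⇒m⊓n≡n N/d≤m)) (sym (m≥n⇒m⊓n≡n (≤-trans N/d≤m (n≤1+n m))))
  where N/d≤m = ≤-pred (≰⇒> (d[1+m]≰N ∘ ≤/⇒*≤ d))

distinct-primes-∤ : ∀ {p q} → Prime p → Prime q → p ≢ q → p ∤ q
distinct-primes-∤ p-prime q-prime p≢q p∣q with prime⇒irreducible q-prime p∣q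
... | inj₁ refl = ¬prime[1] p-prime
... | inj₂ p≡q  = p≢q p≡q

[1+2c]k/[1+2d]≤c : ∀ c d {k} → k ≤ d → suc (c + c) * k / suc (d + d) ≤ c
[1+2c]k/[1+2d]≤c c d {k} k≤d = ≤-pred (m<n*o⇒m/o<n (begin-strict
  suc (c + c) * k                        ≤⟨ *-monoʳ-≤ (suc (c + c)) k≤d ⟩
  suc (c + c) * d                        <⟨ m<m+n _ z<s ⟩
  suc (c + c) * d + suc (c + d)          ≡⟨ identity c d ⟩
  suc c * suc (d + d)                    ∎))
  where
  open ≤-Reasoning
  identity : ∀ c d → suc (c + c) * d + suc (c + d) ≡ suc c * suc (d + d)
  identity = solve-∀

module Reciprocity (h g : ℕ) (p-prime : Prime (suc (h + h))) (q-prime : Prime (suc (g + g)))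
                   (h≢g : h ≢ g) where

  private
    module P = OddPrimeModulus h p-prime
    module Q = OddPrimeModulus g q-prime

  p q : ℕ
  p = suc (h + h)
  q = suc (g + g)

  p∤q : p ∤ q
  p∤q = distinct-primes-∤ p-prime q-prime (h≢g ∘ +-double-injective ∘ suc-injective)

  q∤p : q ∤ p
  q∤p = distinct-primes-∤ q-prime p-prime (h≢g ∘ sym ∘ +-double-injective ∘ suc-injective)

  pj≢qk : ∀ {j k} → j ∈ segment 0 g → k ∈ segment 0 h → p * j ≢ q * k
  pj≢qk {j} {k} j∈ k∈ pj≡qk with euclidsLemma q k p-prime (subst (p ∣_) pj≡qk (∣m⇒∣m*n j ∣-refl))
  ... | inj₁ p∣q = p∤q p∣q
  ... | inj₂ p∣k = P.residue⇒p∤ (P.half⊆residues k∈) p∣k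

  -- Both sides count the points (k, j) of [1, h] × [1, g], split by the line p * j = q * k.
  lattice-points : P.eisensteinSum q + Q.eisensteinSum p ≡ h * g
  lattice-points = begin
    P.eisensteinSum q + Q.eisensteinSum p     ≡⟨ cong₂ _+_ SP≡ΣA SQ≡ΣB ⟩
    sum (map A hs) + sum (map B hs)           ≡⟨ Sum.foldMap-∙ A B hs ⟨
    sum (map (λ k → A k + B k) hs)            ≡⟨ Sum.foldMap-cong hs A+B≡g ⟩
    sum (map (λ _ → g) hs)                    ≡⟨ sum-map-const g hs ⟩
    length hs * g                             ≡⟨ cong (_* g) (length-segment 0 h) ⟩
    h * g                                     ∎
    where
    open ≡-Reasoning
    hs = segment 0 h
    gs = segment 0 g
    A B : ℕ → ℕ
    A k = sum (map (λ j → 𝟙[ p * j ≤ q * k ]) gs)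
    B k = sum (map (λ j → 𝟙[ q * k ≤ p * j ]) gs)
    SP≡ΣA : P.eisensteinSum q ≡ sum (map A hs)
    SP≡ΣA = Sum.foldMap-cong hs λ k∈ →
      sym (trans (count-multiples p _ g) (m≥n⇒m⊓n≡n ([1+2c]k/[1+2d]≤c g h (proj₂ (∈-segment⁻ k∈)))))
    SQ≡ΣB : Q.eisensteinSum p ≡ sum (map B hs)
    SQ≡ΣB = trans (Sum.foldMap-cong gs λ j∈ →
      sym (trans (count-multiples q _ h) (m≥n⇒m⊓n≡n ([1+2c]k/[1+2d]≤c h g (proj₂ (∈-segment⁻ j∈))))))
      (sym (Sum.foldMap-comm (λ k j → 𝟙[ q * k ≤ p * j ]) hs gs))
    A+B≡g : ∀ {k} → k ∈ hs → A k + B k ≡ g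
    A+B≡g {k} k∈ = begin
      A k + B k
        ≡⟨ Sum.foldMap-∙ _ _ gs ⟨
      sum (map (λ j → 𝟙[ p * j ≤ q * k ] + 𝟙[ q * k ≤ p * j ]) gs)
        ≡⟨ Sum.foldMap-cong gs (λ j∈ → 𝟙≤-dichotomy (pj≢qk j∈ k∈)) ⟩
      sum (map (λ _ → 1) gs)
        ≡⟨ sum-map-const 1 gs ⟩
      length gs * 1
        ≡⟨ trans (*-identityʳ _) (length-segment 0 g) ⟩
      g ∎

  quadratic-reciprocity : legendre p q ℤ.* legendre q p ≡ -1ℤ ℤ.^ (h * g)
  quadratic-reciprocity = begin
    legendre p q ℤ.* legendre q p
      ≡⟨ cong₂ ℤ._*_ (Q.eisenstein-lemma (1+n+n≡₂1 h) q∤p) (P.eisenstein-lemma (1+n+n≡₂1 g) p∤q) ⟩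
    -1ℤ ℤ.^ Q.eisensteinSum p ℤ.* -1ℤ ℤ.^ P.eisensteinSum q
      ≡⟨ ℤ.^-distribˡ-+-* -1ℤ (Q.eisensteinSum p) (P.eisensteinSum q) ⟨
    -1ℤ ℤ.^ (Q.eisensteinSum p + P.eisensteinSum q)
      ≡⟨ cong (-1ℤ ℤ.^_) (trans (+-comm (Q.eisensteinSum p) _) lattice-points) ⟩
    -1ℤ ℤ.^ (h * g)
      ∎
    where open ≡-Reasoning

-- Jacobi symbols

Odd : ℕ → Set
Odd n = ∃[ h ] n ≡ suc (h + h)

even-or-odd : ∀ n → (∃[ h ] n ≡ h + h) ⊎ Odd n
even-or-odd zero    = inj₁ (0 , refl)
even-or-odd (suc n) with even-or-odd n
... | inj₁ (h , refl) = inj₂ (h , refl)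
... | inj₂ (h , refl) = inj₁ (suc h , cong suc (sym (+-suc h h)))

odd⇒2∤ : ∀ {n} → Odd n → 2 ∤ n
odd⇒2∤ (h , refl) 2∣n
  with () ← Parity.≈⇒≡ {0} {1} z<s (s≤s (s≤s z≤n))
              (Parity.≈-trans (Parity.≈-sym (Parity.∣⇒≈0 2∣n)) (1+n+n≡₂1 h))

∣odd⇒odd : ∀ {d n} → d ∣ n → Odd n → Odd d
∣odd⇒odd {d} d∣n odd-n with even-or-odd d
... | inj₂ odd-d        = odd-d
... | inj₁ (h , refl) = contradiction (∣-trans (2∣n+n h) d∣n) (odd⇒2∤ odd-n)

product-odd : ∀ {ps} → All Odd ps → ∃[ z ] product ps ≡ suc (z + z) × z ≡₂ sum (map ⌊_/2⌋ ps)
product-odd []                      = 0 , refl , Parity.≈-refl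
product-odd {ps = p ∷ ps} ((h , refl) ∷ odd-ps) with z , Πps≡1+z+z , z≡₂Σ ← product-odd odd-ps =
  y , trans (cong (suc (h + h) *_) Πps≡1+z+z) (identity h z) , y≡₂
  where
  open import Relation.Binary.Reasoning.Setoid Parity.≈-setoid
  y = (h * z + h * z) + (h + z)
  identity : ∀ h z → suc (h + h) * suc (z + z) ≡
                     suc (((h * z + h * z) + (h + z)) + ((h * z + h * z) + (h + z)))
  identity = solve-∀
  y≡₂ : y ≡₂ ⌊ suc (h + h) /2⌋ + sum (map ⌊_/2⌋ ps)
  y≡₂ = begin
    (h * z + h * z) + (h + z)              ≈⟨ Parity.+-congʳ (h + z) (n+n≡₂0 (h * z)) ⟩
    h + z                                  ≈⟨ Parity.+-congˡ h z≡₂Σ ⟩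
    h + sum (map ⌊_/2⌋ ps)                 ≡⟨ cong (_+ sum (map ⌊_/2⌋ ps)) (n≡⌈n+n/2⌉ h) ⟩
    ⌊ suc (h + h) /2⌋ + sum (map ⌊_/2⌋ ps) ∎

odd-product-half : ∀ {u xs} → All Odd xs → product xs ≡ suc (u + u) → u ≡₂ sum (map ⌊_/2⌋ xs)
odd-product-half odd-xs Πxs≡1+u+u with z , Πxs≡1+z+z , z≡₂ ← product-odd odd-xs =
  subst (_≡₂ _) (+-double-injective (suc-injective (trans (sym Πxs≡1+z+z) Πxs≡1+u+u))) z≡₂

legendre-1 : ∀ n → legendre 1 (2 + n) ≡ 1ℤ
legendre-1 n = legendre-QR {1} {2 + n} (λ 2+n∣1 → <⇒≱ (s≤s (s≤s z≤n)) (∣⇒≤ 2+n∣1))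
                                        (square⇒isQR (suc n) {x = 1} (Modulo.≈-refl (2 + n)))

legendre-isMonoidHomomorphism : ∀ {q} → Prime q → Odd q →
                                IsMonoidHomomorphism *-1-rawMonoid ℤ.*-1-rawMonoid (λ a → legendre a q)
legendre-isMonoidHomomorphism q-prime (zero  , refl) = contradiction q-prime ¬prime[1]
legendre-isMonoidHomomorphism q-prime (suc h , refl) = record
  { isMagmaHomomorphism = record
    { isRelHomomorphism = record { cong = cong (λ a → legendre a (suc (suc h + suc h))) }
    ; homo              = OddPrimeModulus.legendre-* (suc h) q-prime
    }
  ; ε-homo = legendre-1 (h + suc h)
  }

legendre-reciprocity : ∀ {p q} → Prime p → Odd p → Prime q → Odd q → p ≢ q →
                       legendre p q ℤ.* legendre q p ≡ -1ℤ ℤ.^ (⌊ p /2⌋ * ⌊ q /2⌋)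
legendre-reciprocity p-prime (h , refl) q-prime (g , refl) p≢q =
  trans (Reciprocity.quadratic-reciprocity h g p-prime q-prime (λ { refl → p≢q refl }))
        (cong₂ (λ x y → -1ℤ ℤ.^ (x * y)) (n≡⌈n+n/2⌉ h) (n≡⌈n+n/2⌉ g))

-- isQR a q depends on a only through a % q.
legendre-cong : ∀ {a b} q → a % suc q ≡ b % suc q → legendre a (suc q) ≡ legendre b (suc q)
legendre-cong {a} {b} q a%q≡b%q with suc q ∣? a
... | yes q∣a =
  trans (legendre-∣ q∣a) (sym (legendre-∣ {b} (≈0⇒∣ (≈-trans (mk≈ (sym a%q≡b%q)) (∣⇒≈0 q∣a)))))
  where open Modulo (suc q)
... | no  q∤a = begin
  legendre a (suc q)                    ≡⟨ legendre-∤ q∤a ⟩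
  (if isQR a (suc q) then 1ℤ else -1ℤ)  ≡⟨ cong (λ r → if any (λ x → x * x % suc q ≡ᵇ r) (upTo (suc q))
                                                      then 1ℤ else -1ℤ) a%q≡b%q ⟩
  (if isQR b (suc q) then 1ℤ else -1ℤ)  ≡⟨ legendre-∤ q∤b ⟨
  legendre b (suc q)                    ∎
  where
  open ≡-Reasoning
  open Modulo (suc q) using (mk≈; ∣⇒≈0; ≈0⇒∣; ≈-trans)
  q∤b : suc q ∤ b
  q∤b q∣b = q∤a (≈0⇒∣ (≈-trans (mk≈ a%q≡b%q) (∣⇒≈0 q∣b)))

legendre-+-multiple : ∀ {a m q} → Prime q → q ∣ m → legendre (m + a) q ≡ legendre a q
legendre-+-multiple {a} {m} {suc q} _ q∣m = legendre-cong {m + a} {a} q (%-remove-+ˡ a q∣m)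

legendre²≡1 : ∀ {a q} → q ∤ a → legendre a q ℤ.* legendre a q ≡ 1ℤ
legendre²≡1 {a} {q} q∤a rewrite legendre-∤ q∤a with isQR a q
... | true  = refl
... | false = refl

legendre-square-nonneg : ∀ {q} k → Prime q → ∃[ t ] legendre (k * k) q ≡ ℤ.+ t
legendre-square-nonneg {suc q} k _ with suc q ∣? k * k
... | yes q∣k² = 0 , legendre-∣ q∣k²
... | no  q∤k² = 1 , legendre-QR {k * k} q∤k² (square⇒isQR q {x = k} (Modulo.≈-refl (suc q)))

legendre-product : ∀ {q} → Prime q → Odd q → ∀ ps →
                   legendre (product ps) q ≡ ℤProduct.foldMap (λ p → legendre p q) ps
legendre-product {q} q-prime q-odd ps = trans (cong (λ n → legendre (product n) q) (sym (map-id ps)))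
  (foldMap-homo *-1-commutativeMonoid ℤ.*-1-commutativeMonoid (legendre-isMonoidHomomorphism q-prime q-odd) (λ p → p) ps)

primeFactors : ∀ n .{{_ : NonZero n}} → List ℕ
primeFactors n = PrimeFactorisation.factors (factorise n)

primeFactors-prime : ∀ n .{{_ : NonZero n}} {q} → q ∈ primeFactors n → Prime q
primeFactors-prime n = All.lookup (PrimeFactorisation.factorsPrime (factorise n))

product-primeFactors : ∀ n .{{_ : NonZero n}} → product (primeFactors n) ≡ n
product-primeFactors n = sym (PrimeFactorisation.isFactorisation (factorise n))

primeFactors-∣ : ∀ n .{{_ : NonZero n}} {q} → q ∈ primeFactors n → q ∣ n
primeFactors-∣ n q∈ = subst (_ ∣_) (product-primeFactors n) (∈⇒∣product q∈)
  where
  ∈⇒∣product : ∀ {q xs} → q ∈ xs → q ∣ product xs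
  ∈⇒∣product {xs = x ∷ xs} (here refl) = ∣m⇒∣m*n (product xs) ∣-refl
  ∈⇒∣product {xs = x ∷ xs} (there q∈) = ∣n⇒∣m*n x (∈⇒∣product q∈)

coprime-prime-∤ : ∀ {a n q} → Coprime a n → Prime q → q ∣ n → q ∤ a
coprime-prime-∤ a⊥n q-prime q∣n q∣a = ¬prime[1] (subst Prime (a⊥n (q∣a , q∣n)) q-prime)

jacobi-+-multiple : ∀ {a m} n → suc n ∣ m → jacobi (m + a) (suc n) ≡ jacobi a (suc n)
jacobi-+-multiple n n∣m = ℤProduct.foldMap-cong (primeFactors (suc n)) λ q∈ →
  legendre-+-multiple (primeFactors-prime (suc n) q∈) (∣-trans (primeFactors-∣ (suc n) q∈) n∣m)

jacobi²≡1 : ∀ {a} n → Coprime a (suc n) → jacobi a (suc n) ℤ.* jacobi a (suc n) ≡ 1ℤ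
jacobi²≡1 {a} n a⊥n = begin
  jacobi a (suc n) ℤ.* jacobi a (suc n)
    ≡⟨ ℤProduct.foldMap-∙ (λ q → legendre a q) (λ q → legendre a q) qs ⟨
  ℤProduct.foldMap (λ q → legendre a q ℤ.* legendre a q) qs
    ≡⟨ ℤProduct.foldMap-cong qs (λ q∈ → legendre²≡1
         (coprime-prime-∤ a⊥n (primeFactors-prime (suc n) q∈) (primeFactors-∣ (suc n) q∈))) ⟩
  ℤProduct.foldMap (λ _ → 1ℤ) qs
    ≡⟨ ℤProduct.foldMap-ε qs ⟩
  1ℤ ∎
  where
  open ≡-Reasoning
  qs = primeFactors (suc n)

jacobi-square-nonneg : ∀ k n → ∃[ t ] jacobi (k * k) (suc n) ≡ ℤ.+ t
jacobi-square-nonneg k n = ℤProduct.foldMap-closed (λ x → ∃[ t ] x ≡ ℤ.+ t) (1 , refl)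
  (λ { (s , refl) (t , refl) → s * t , sym (ℤ.pos-* s t) })
  (primeFactors (suc n)) (λ q∈ → legendre-square-nonneg k (primeFactors-prime (suc n) q∈))

jacobi-expand : ∀ {a} .{{_ : NonZero a}} n → Odd (suc n) →
                jacobi a (suc n) ≡ ℤProduct.foldMap (λ q → ℤProduct.foldMap (λ p → legendre p q) (primeFactors a))
                                                   (primeFactors (suc n))
jacobi-expand {a} n odd = ℤProduct.foldMap-cong (primeFactors (suc n)) λ {q} q∈ →
  trans (cong (λ x → legendre x q) (sym (product-primeFactors a)))
        (legendre-product (primeFactors-prime (suc n) q∈) (∣odd⇒odd (primeFactors-∣ (suc n) q∈) odd) (primeFactors a))

-1^-bilinear : ∀ (f g : ℕ → ℕ) ps qs →
               ℤProduct.foldMap (λ q → ℤProduct.foldMap (λ p → -1ℤ ℤ.^ (f p * g q)) ps) qs ≡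
               -1ℤ ℤ.^ (sum (map f ps) * sum (map g qs))
-1^-bilinear f g ps qs = begin
  ℤProduct.foldMap (λ q → ℤProduct.foldMap (λ p → -1ℤ ℤ.^ (f p * g q)) ps) qs
    ≡⟨ ℤProduct.foldMap-cong qs (λ {q} _ → sym (-1^-homo (λ p → f p * g q) ps)) ⟩
  ℤProduct.foldMap (λ q → -1ℤ ℤ.^ sum (map (λ p → f p * g q) ps)) qs
    ≡⟨ -1^-homo _ qs ⟨
  -1ℤ ℤ.^ sum (map (λ q → sum (map (λ p → f p * g q) ps)) qs)
    ≡⟨ cong (-1ℤ ℤ.^_) (trans (Sum.foldMap-cong qs (λ {q} _ → sum-map-*ʳ (g q) f ps))
                              (sum-map-*ˡ (sum (map f ps)) g qs)) ⟩
  -1ℤ ℤ.^ (sum (map f ps) * sum (map g qs))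
    ∎
  where
  open ≡-Reasoning
  -1^-homo = foldMap-homo +-0-commutativeMonoid ℤ.*-1-commutativeMonoid (ℤ.^-isMonoidHomomorphism -1ℤ)

jacobi-reciprocity : ∀ {a c v w} → a ≡ suc (v + v) → c ≡ suc (w + w) → Coprime a c →
                     jacobi a c ℤ.* jacobi c a ≡ -1ℤ ℤ.^ (v * w)
jacobi-reciprocity {a} {c} {v} {w} refl refl a⊥c = begin
  jacobi a c ℤ.* jacobi c a
    ≡⟨ cong₂ ℤ._*_ (jacobi-expand (w + w) (w , refl)) (jacobi-expand (v + v) (v , refl)) ⟩
  Π Q (λ q → Π P (λ p → legendre p q)) ℤ.* Π P (λ p → Π Q (λ q → legendre q p))
    ≡⟨ cong (Π Q (λ q → Π P (λ p → legendre p q)) ℤ.*_) (ℤProduct.foldMap-comm (λ p q → legendre q p) P Q) ⟩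
  Π Q (λ q → Π P (λ p → legendre p q)) ℤ.* Π Q (λ q → Π P (λ p → legendre q p))
    ≡⟨ ℤProduct.foldMap-∙ _ _ Q ⟨
  Π Q (λ q → Π P (λ p → legendre p q) ℤ.* Π P (λ p → legendre q p))
    ≡⟨ ℤProduct.foldMap-cong Q (λ q∈ → trans (sym (ℤProduct.foldMap-∙ _ _ P)) (ℤProduct.foldMap-cong P λ p∈ →
         legendre-reciprocity (prime-P p∈) (odd-P p∈) (prime-Q q∈) (odd-Q q∈) (P≢Q p∈ q∈))) ⟩
  Π Q (λ q → Π P (λ p → -1ℤ ℤ.^ (⌊ p /2⌋ * ⌊ q /2⌋)))
    ≡⟨ -1^-bilinear ⌊_/2⌋ ⌊_/2⌋ P Q ⟩
  -1ℤ ℤ.^ (sum (map ⌊_/2⌋ P) * sum (map ⌊_/2⌋ Q))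
    ≡⟨ -1^-cong (Parity.*-cong (odd-product-half {v} (All.tabulate odd-P) (product-primeFactors a))
                                  (odd-product-half {w} (All.tabulate odd-Q) (product-primeFactors c))) ⟨
  -1ℤ ℤ.^ (v * w)
    ∎
  where
  open ≡-Reasoning
  P = primeFactors a
  Q = primeFactors c
  Π : List ℕ → (ℕ → ℤ) → ℤ
  Π xs f = ℤProduct.foldMap f xs
  prime-P = primeFactors-prime a
  prime-Q = primeFactors-prime c
  odd-P : ∀ {p} → p ∈ P → Odd p
  odd-P p∈ = ∣odd⇒odd (primeFactors-∣ a p∈) (v , refl)
  odd-Q : ∀ {q} → q ∈ Q → Odd q
  odd-Q q∈ = ∣odd⇒odd (primeFactors-∣ c q∈) (w , refl)
  P≢Q : ∀ {p q} → p ∈ P → q ∈ Q → p ≢ q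
  P≢Q p∈ q∈ refl = coprime-prime-∤ (coprime-sym a⊥c) (prime-P p∈) (primeFactors-∣ a p∈) (primeFactors-∣ c q∈)

jacobi-symmetric : ∀ {a c v k} → a ≡ suc (v + v) → c ≡ suc (4 * k) → Coprime a c → jacobi a c ≡ jacobi c a
jacobi-symmetric {a} {c} {v} {k} refl refl a⊥c = begin
  x                ≡⟨ ℤ.*-identityʳ x ⟨
  x ℤ.* 1ℤ         ≡⟨ cong (x ℤ.*_) (jacobi²≡1 (v + v) (coprime-sym a⊥c)) ⟨
  x ℤ.* (y ℤ.* y)  ≡⟨ ℤ.*-assoc x y y ⟨
  x ℤ.* y ℤ.* y    ≡⟨ cong (ℤ._* y) x*y≡1 ⟩
  1ℤ ℤ.* y         ≡⟨ ℤ.*-identityˡ y ⟩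
  y                ∎
  where
  open ≡-Reasoning
  x = jacobi a c
  y = jacobi c a
  x*y≡1 : x ℤ.* y ≡ 1ℤ
  x*y≡1 = trans (jacobi-reciprocity {v = v} {2 * k} refl (cong suc (*-distribʳ-+ k 2 2)) a⊥c)
                (-1^-cong (Parity.∣⇒≈0 (∣n⇒∣m*n v (∣m⇒∣m*n k (∣-refl {2})))))

-- The orbit of (3, 5)

coprime-+-multiple : ∀ {m n} k → Coprime m n → Coprime (k * n + m) n
coprime-+-multiple k m⊥n (d∣kn+m , d∣n) = m⊥n (∣m+n∣m⇒∣n d∣kn+m (∣n⇒∣m*n k d∣n) , d∣n)

OrbitInvariant : Vec2 → Set
OrbitInvariant (a , b) = (∃[ k ] a ≡ 3 + 4 * k) × (∃[ j ] b ≡ 1 + 4 * j) × Coprime a b × jacobi a b ≡ -1ℤ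

invariant-base : OrbitInvariant (3 , 5)
invariant-base = (0 , refl) , (1 , refl) , gcd≡1⇒coprime refl , refl

invariant-T : ∀ {a b} → OrbitInvariant (a , b) → OrbitInvariant (4 * b + a , b)
invariant-T {b = b} ((k , refl) , (j , refl) , a⊥b , jacobi≡-1) =
  (b + k , 4b+a≡3+4[b+k] b k) , (j , refl) , coprime-+-multiple 4 a⊥b ,
  trans (jacobi-+-multiple (4 * j) (n∣m*n 4)) jacobi≡-1
  where
  4b+a≡3+4[b+k] : ∀ b k → 4 * b + (3 + 4 * k) ≡ 3 + 4 * (b + k)
  4b+a≡3+4[b+k] = solve-∀

invariant-U : ∀ {a b} → OrbitInvariant (a , b) → OrbitInvariant (a , 4 * a + b)
invariant-U {a} {b} ((k , refl) , (j , refl) , a⊥b , jacobi≡-1) =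
  (k , refl) , (a + j , 4a+b≡1+4[a+j] k j) , a⊥4a+b , (begin
    jacobi a (4 * a + b)   ≡⟨ jacobi-symmetric {v = 1 + 2 * k} {k = a + j} (a≡1+2w k) (4a+b≡1+4[a+j] k j) a⊥4a+b ⟩
    jacobi (4 * a + b) a   ≡⟨ jacobi-+-multiple (2 + 4 * k) (n∣m*n 4) ⟩
    jacobi b a             ≡⟨ jacobi-symmetric {v = 1 + 2 * k} {k = j} (a≡1+2w k) refl a⊥b ⟨
    jacobi a b             ≡⟨ jacobi≡-1 ⟩
    -1ℤ                    ∎)
  where
  open ≡-Reasoning
  a≡1+2w : ∀ k → 3 + 4 * k ≡ suc ((1 + 2 * k) + (1 + 2 * k))
  a≡1+2w = solve-∀
  4a+b≡1+4[a+j] : ∀ k j → 4 * (3 + 4 * k) + (1 + 4 * j) ≡ 1 + 4 * ((3 + 4 * k) + j)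
  4a+b≡1+4[a+j] = solve-∀
  a⊥4a+b : Coprime a (4 * a + b)
  a⊥4a+b = coprime-sym (coprime-+-multiple 4 (coprime-sym a⊥b))

·-⊗ : ∀ M N v → (M ⊗ N) · v ≡ M · (N · v)
·-⊗ (mat a b c d) (mat a′ b′ c′ d′) (x , y) =
  cong₂ _,_ (identity a b a′ b′ c′ d′ x y) (identity c d a′ b′ c′ d′ x y)
  where
  identity : ∀ a b a′ b′ c′ d′ x y →
             (a * a′ + b * c′) * x + (a * b′ + b * d′) * y ≡ a * (a′ * x + b′ * y) + b * (c′ * x + d′ * y)
  identity = solve-∀

invariant-Λ : ∀ {M} → InΛ M → ∀ {v} → OrbitInvariant v → OrbitInvariant (M · v)
invariant-Λ genT {x , y} inv = subst OrbitInvariant T4·v≡ (invariant-T inv)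
  where
  T4·v≡ : (4 * y + x , y) ≡ T4 · (x , y)
  T4·v≡ = cong₂ _,_ (trans (+-comm (4 * y) x) (cong (_+ 4 * y) (sym (*-identityˡ x)))) (sym (*-identityˡ y))
invariant-Λ genU {x , y} inv = subst OrbitInvariant U4·v≡ (invariant-U inv)
  where
  U4·v≡ : (x , 4 * x + y) ≡ U4 · (x , y)
  U4·v≡ = cong₂ _,_ (sym (trans (+-identityʳ (1 * x)) (*-identityˡ x))) (cong (4 * x +_) (sym (*-identityˡ y)))
invariant-Λ (mul {M} {N} M∈Λ N∈Λ) {v} inv =
  subst OrbitInvariant (sym (·-⊗ M N v)) (invariant-Λ M∈Λ (invariant-Λ N∈Λ inv))

invariant-O : ∀ {v} → InO v → OrbitInvariant v
invariant-O (orb M∈Λ) = invariant-Λ M∈Λ invariant-base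

lemma6p1 : ∀ (a b : ℕ) → InO (a , b) →
             ¬ (2 ∣ b) × jacobi a b ≡ -[1+ 0 ] × ¬ (∃[ k ] a ≡ k * k)
lemma6p1 a b a,b∈O with (k , refl) , (j , refl) , _ , jacobi≡-1 ← invariant-O a,b∈O =
  odd⇒2∤ (2 * j , cong suc (*-distribʳ-+ j 2 2)) , jacobi≡-1 , not-square
  where
  not-square : ¬ (∃[ m ] 3 + 4 * k ≡ m * m)
  not-square (m , a≡m²) with t , jacobi≡+t ← jacobi-square-nonneg m (4 * j)
    with () ← trans (sym jacobi≡+t) (subst (λ x → jacobi x (1 + 4 * j) ≡ -1ℤ) a≡m² jacobi≡-1)
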